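{- For types $A,B,C$: if $A\Rightarrow B\equiv C\Rightarrow\tau$, then either ($A\equiv C$ and $B\equiv\tau$), or there is a type $B'$ with $C\equiv A\wedge B'$ and $B\equiv B'\Rightarrow\tau$.
   Context: Types are generated by $A ::= \tau \mid A\Rightarrow A \mid A\wedge A$, where $\tau$ is the only atomic type ($\Rightarrow$ associates to the right). Type equivalence $\equiv$ is the smallest congruence on types such that $A\wedge B\equiv B\wedge A$, $A\wedge(B\wedge C)\equiv(A\wedge B)\wedge C$, $A\Rightarrow(B\wedge C)\equiv(A\Rightarrow B)\wedge(A\Rightarrow C)$ and $(A\wedge B)\Rightarrow C\equiv A\Rightarrow B\Rightarrow C$. -}

module Defs where

infixr 6 _⇒_
infixl 7 _∧_
infix 4 _≡ᵀ_

data Type : Set where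
  τ   : Type
  _⇒_ : Type → Type → Type
  _∧_ : Type → Type → Type

data _≡ᵀ_ : Type → Type → Set where
  refl  : ∀ {A} → A ≡ᵀ A
  sym   : ∀ {A B} → A ≡ᵀ B → B ≡ᵀ A
  trans : ∀ {A B C} → A ≡ᵀ B → B ≡ᵀ C → A ≡ᵀ C
  cong⇒ : ∀ {A A' B B'} → A ≡ᵀ A' → B ≡ᵀ B' → (A ⇒ B) ≡ᵀ (A' ⇒ B')
  cong∧ : ∀ {A A' B B'} → A ≡ᵀ A' → B ≡ᵀ B' → (A ∧ B) ≡ᵀ (A' ∧ B')
  comm    : ∀ {A B} → (A ∧ B) ≡ᵀ (B ∧ A)
  assoc   : ∀ {A B C} → (A ∧ (B ∧ C)) ≡ᵀ ((A ∧ B) ∧ C)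
  distr   : ∀ {A B C} → (A ⇒ (B ∧ C)) ≡ᵀ ((A ⇒ B) ∧ (A ⇒ C))
  curry   : ∀ {A B C} → ((A ∧ B) ⇒ C) ≡ᵀ (A ⇒ (B ⇒ C))

module Submission where

-- Using the four axioms, every type is equivalent to a conjunction
-- P₁ ∧ … ∧ Pₙ (n ≥ 1) of primes, where a prime is Q₁ ⇒ … ⇒ Qₖ ⇒ τ with prime
-- premises Qᵢ. Up to ≡ᵀ, a prime is determined by the multiset of its
-- premises and a type by the multiset of its prime factors.
--
-- Two facts are proved: soundness (A ≡ᵀ B implies nf A ~ nf B, by induction
-- on the derivation) and readback (A ≡ᵀ ⋀ (nf A), where ⋀ turns a list of
-- primes back into a conjunction); as ⋀ respects _~_, normal forms decide ≡ᵀ.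
--
-- For the theorem, nf (C ⇒ τ) is the single prime with premises nf C, while
-- nf (A ⇒ B) adds the premises nf A to every prime of nf B. Hence nf B is a
-- single prime with premises M such that nf A ++ M ~ nf C. Either M is empty,
-- giving A ≡ᵀ C and B ≡ᵀ τ, or B' = ⋀ M satisfies C ≡ᵀ A ∧ B', B ≡ᵀ B' ⇒ τ.

open import Defs
open import Data.Product using (Σ; _×_; _,_)
open import Data.Sum using (_⊎_; inj₁; inj₂)
open import Data.List using (List; []; _∷_; _++_; map)
open import Data.List.Properties using (++-assoc; ++-identityʳ; map-++; map-∘; map-cong)
open import Data.List.NonEmpty using (List⁺; _∷_; toList; _⁺++⁺_) renaming (map to map⁺)
open import Relation.Binary.Bundles using (Setoid)
open import Relation.Binary.PropositionalEquality as Eq using (_≡_)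
import Relation.Binary.Reasoning.Setoid as SetoidReasoning

-- arr [Q₁, …, Qₖ] is the prime Q₁ ⇒ … ⇒ Qₖ ⇒ τ; in particular arr [] is τ.
data Prime : Set where
  arr : List Prime → Prime

infix 4 _≅_ _~_

data _≅_ : Prime → Prime → Set
data _~_ : List Prime → List Prime → Set

data _≅_ where
  arr-cong : ∀ {M N} → M ~ N → arr M ≅ arr N

data _~_ where
  []~     : [] ~ []
  _∷~_    : ∀ {p q M N} → p ≅ q → M ~ N → (p ∷ M) ~ (q ∷ N)
  swap~   : ∀ {p q M} → (p ∷ q ∷ M) ~ (q ∷ p ∷ M)
  ~-trans : ∀ {L M N} → L ~ M → M ~ N → L ~ N

≅-refl : ∀ {p} → p ≅ p
~-refl : ∀ {L} → L ~ L
≅-refl {arr M} = arr-cong ~-refl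
~-refl {[]}    = []~
~-refl {p ∷ L} = ≅-refl ∷~ ~-refl

~-reflexive : ∀ {L M} → L ≡ M → L ~ M
~-reflexive Eq.refl = ~-refl

≅-sym : ∀ {p q} → p ≅ q → q ≅ p
~-sym : ∀ {L M} → L ~ M → M ~ L
≅-sym (arr-cong e)  = arr-cong (~-sym e)
~-sym []~           = []~
~-sym (e ∷~ f)      = ≅-sym e ∷~ ~-sym f
~-sym swap~         = swap~
~-sym (~-trans e f) = ~-trans (~-sym f) (~-sym e)

≅-trans : ∀ {p q r} → p ≅ q → q ≅ r → p ≅ r
≅-trans (arr-cong e) (arr-cong f) = arr-cong (~-trans e f)

~-[] : ∀ {L} → L ~ [] → L ≡ []
~-[] []~ = Eq.refl
~-[] (~-trans e f) with ~-[] f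
... | Eq.refl = ~-[] e

~-singleton : ∀ {L q} → L ~ q ∷ [] → Σ Prime λ p → (L ≡ p ∷ []) × (p ≅ q)
~-singleton (e ∷~ f) with ~-[] f
... | Eq.refl = _ , Eq.refl , e
~-singleton (~-trans e f) with ~-singleton f
... | r , Eq.refl , r≅q with ~-singleton e
...   | p , Eq.refl , p≅r = p , Eq.refl , ≅-trans p≅r r≅q

∷-shift : ∀ p M N → (p ∷ M ++ N) ~ (M ++ p ∷ N)
∷-shift p []      N = ~-refl
∷-shift p (q ∷ M) N = ~-trans swap~ (≅-refl ∷~ ∷-shift p M N)

++-comm~ : ∀ M N → (M ++ N) ~ (N ++ M)
++-comm~ []      N = ~-reflexive (Eq.sym (++-identityʳ N))
++-comm~ (p ∷ M) N = ~-trans (≅-refl ∷~ ++-comm~ M N) (∷-shift p N M)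

++-cong~ : ∀ {M M' N N'} → M ~ M' → N ~ N' → (M ++ N) ~ (M' ++ N')
++-cong~ {M' = M'} {N = N} {N' = N'} M~M' N~N' = ~-trans (congˡ M~M') (congʳ M')
  where
  congˡ : ∀ {M M'} → M ~ M' → (M ++ N) ~ (M' ++ N)
  congˡ []~           = ~-refl
  congˡ (e ∷~ f)      = e ∷~ congˡ f
  congˡ swap~         = swap~
  congˡ (~-trans e f) = ~-trans (congˡ e) (congˡ f)

  congʳ : ∀ M → (M ++ N) ~ (M ++ N')
  congʳ []      = N~N'
  congʳ (p ∷ M) = ≅-refl ∷~ congʳ M

-- Adding premises: X ▷ p is the prime ⋀ X ⇒ p.

_▷_ : List Prime → Prime → Prime
X ▷ arr M = arr (X ++ M)

▷-map-cong : ∀ {X X' L L'} → X ~ X' → L ~ L' → map (X ▷_) L ~ map (X' ▷_) L'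
▷-map-cong {X} {X'} {L} X~X' L~L' = ~-trans (pointwise L) (listwise L~L')
  where
  pointwise : ∀ L → map (X ▷_) L ~ map (X' ▷_) L
  pointwise []          = []~
  pointwise (arr M ∷ L) = arr-cong (++-cong~ X~X' ~-refl) ∷~ pointwise L

  listwise : ∀ {L L'} → L ~ L' → map (X' ▷_) L ~ map (X' ▷_) L'
  listwise []~                = []~
  listwise (arr-cong e ∷~ f)  = arr-cong (++-cong~ ~-refl e) ∷~ listwise f
  listwise swap~              = swap~
  listwise (~-trans e f)      = ~-trans (listwise e) (listwise f)

map-▷-++ : ∀ X Y L → map ((X ++ Y) ▷_) L ≡ map (X ▷_) (map (Y ▷_) L)
map-▷-++ X Y L = Eq.trans (map-cong ▷-++ L) (map-∘ L)
  where
  ▷-++ : ∀ p → (X ++ Y) ▷ p ≡ X ▷ (Y ▷ p)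
  ▷-++ (arr M) = Eq.cong arr (++-assoc X Y M)

nf : Type → List⁺ Prime
nf τ       = arr [] ∷ []
nf (A ⇒ B) = map⁺ (toList (nf A) ▷_) (nf B)
nf (A ∧ B) = nf A ⁺++⁺ nf B

NF : Type → List Prime
NF A = toList (nf A)

sound : ∀ {A B} → A ≡ᵀ B → NF A ~ NF B
sound refl                = ~-refl
sound (sym e)             = ~-sym (sound e)
sound (trans e f)         = ~-trans (sound e) (sound f)
sound (cong⇒ e f)         = ▷-map-cong (sound e) (sound f)
sound (cong∧ e f)         = ++-cong~ (sound e) (sound f)
sound (comm {A} {B})      = ++-comm~ (NF A) (NF B)
sound (assoc {A} {B} {C}) = ~-reflexive (Eq.sym (++-assoc (NF A) (NF B) (NF C)))
sound (distr {A} {B} {C}) = ~-reflexive (map-++ (NF A ▷_) (NF B) (NF C))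
sound (curry {A} {B} {C}) = ~-reflexive (map-▷-++ (NF A) (NF B) (NF C))

≡ᵀ-setoid : Setoid _ _
≡ᵀ-setoid = record
  { Carrier       = Type
  ; _≈_           = _≡ᵀ_
  ; isEquivalence = record { refl = refl ; sym = sym ; trans = trans }
  }

open SetoidReasoning ≡ᵀ-setoid

infixr 6 _⇒*_
infixl 7 _∧*_

⟦_⟧ : Prime → Type
_⇒*_ : List Prime → Type → Type
⟦ arr M ⟧    = M ⇒* τ
[] ⇒* T      = T
(p ∷ M) ⇒* T = ⟦ p ⟧ ⇒ M ⇒* T

_∧*_ : Type → List Prime → Type
T ∧* []      = T
T ∧* (p ∷ L) = (T ∧ ⟦ p ⟧) ∧* L

⋀ : List⁺ Prime → Type
⋀ (p ∷ L) = ⟦ p ⟧ ∧* L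

⇒-exchange : ∀ {A B C} → A ⇒ B ⇒ C ≡ᵀ B ⇒ A ⇒ C
⇒-exchange = trans (sym curry) (trans (cong⇒ comm refl) curry)

∧-exchange : ∀ {A B C} → (A ∧ B) ∧ C ≡ᵀ (A ∧ C) ∧ B
∧-exchange = trans (sym assoc) (trans (cong∧ refl comm) assoc)

⟦⟧-cong : ∀ {p q} → p ≅ q → ⟦ p ⟧ ≡ᵀ ⟦ q ⟧
⇒*-cong : ∀ {M N T} → M ~ N → M ⇒* T ≡ᵀ N ⇒* T
⟦⟧-cong (arr-cong e)  = ⇒*-cong e
⇒*-cong []~           = refl
⇒*-cong (e ∷~ f)      = cong⇒ (⟦⟧-cong e) (⇒*-cong f)
⇒*-cong swap~         = ⇒-exchange
⇒*-cong (~-trans e f) = trans (⇒*-cong e) (⇒*-cong f)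

∧*-congˡ : ∀ {T T'} L → T ≡ᵀ T' → T ∧* L ≡ᵀ T' ∧* L
∧*-congˡ []      t = t
∧*-congˡ (p ∷ L) t = ∧*-congˡ L (cong∧ t refl)

∧*-cong : ∀ {T T' L L'} → T ≡ᵀ T' → L ~ L' → T ∧* L ≡ᵀ T' ∧* L'
∧*-cong t []~             = t
∧*-cong t (e ∷~ f)        = ∧*-cong (cong∧ t (⟦⟧-cong e)) f
∧*-cong t (swap~ {M = M}) = ∧*-congˡ M (trans (cong∧ (cong∧ t refl) refl) ∧-exchange)
∧*-cong t (~-trans e f)   = trans (∧*-cong t e) (∧*-cong refl f)

-- ⋀ respects _~_; a chain of ~-steps between nonempty lists only passes
-- through nonempty lists, by ~-[].
⋀-cong : ∀ {xs ys} → toList xs ~ toList ys → ⋀ xs ≡ᵀ ⋀ ys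
⋀-cong (e ∷~ f)                  = ∧*-cong (⟦⟧-cong e) f
⋀-cong (swap~ {M = M})           = ∧*-congˡ M comm
⋀-cong (~-trans {M = []} e f)    with ~-[] e
... | ()
⋀-cong (~-trans {M = _ ∷ _} e f) = trans (⋀-cong e) (⋀-cong f)

∧*-assoc : ∀ T U L → (T ∧ U) ∧* L ≡ᵀ T ∧ (U ∧* L)
∧*-assoc T U []      = refl
∧*-assoc T U (p ∷ L) = trans (∧*-congˡ L (sym assoc)) (∧*-assoc T (U ∧ ⟦ p ⟧) L)

∧*-++ : ∀ T L K → T ∧* (L ++ K) ≡ᵀ T ∧* L ∧* K
∧*-++ T []      K = refl
∧*-++ T (p ∷ L) K = ∧*-++ (T ∧ ⟦ p ⟧) L K

⋀-++ : ∀ xs ys → ⋀ (xs ⁺++⁺ ys) ≡ᵀ ⋀ xs ∧ ⋀ ys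
⋀-++ (p ∷ L) (q ∷ K) = trans (∧*-++ ⟦ p ⟧ L (q ∷ K)) (∧*-assoc (⟦ p ⟧ ∧* L) ⟦ q ⟧ K)

∧*-curry : ∀ T L R → (T ∧* L) ⇒ R ≡ᵀ T ⇒ L ⇒* R
∧*-curry T []      R = refl
∧*-curry T (p ∷ L) R = trans (∧*-curry (T ∧ ⟦ p ⟧) L R) curry

⋀-curry : ∀ xs R → ⋀ xs ⇒ R ≡ᵀ toList xs ⇒* R
⋀-curry (p ∷ L) R = ∧*-curry ⟦ p ⟧ L R

⇒*-++ : ∀ X M T → (X ++ M) ⇒* T ≡ᵀ X ⇒* M ⇒* T
⇒*-++ []      M T = refl
⇒*-++ (p ∷ X) M T = cong⇒ refl (⇒*-++ X M T)

▷-readback : ∀ X p → ⟦ X ▷ p ⟧ ≡ᵀ X ⇒* ⟦ p ⟧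
▷-readback X (arr M) = ⇒*-++ X M τ

⇒*-distr : ∀ X {T U} → X ⇒* (T ∧ U) ≡ᵀ (X ⇒* T) ∧ (X ⇒* U)
⇒*-distr []      = refl
⇒*-distr (p ∷ X) = trans (cong⇒ refl (⇒*-distr X)) distr

⇒*-∧* : ∀ X T L → X ⇒* (T ∧* L) ≡ᵀ (X ⇒* T) ∧* map (X ▷_) L
⇒*-∧* X T []      = refl
⇒*-∧* X T (p ∷ L) = trans (⇒*-∧* X (T ∧ ⟦ p ⟧) L)
  (∧*-congˡ (map (X ▷_) L) (trans (⇒*-distr X) (cong∧ refl (sym (▷-readback X p)))))

⇒*-⋀ : ∀ X xs → X ⇒* ⋀ xs ≡ᵀ ⋀ (map⁺ (X ▷_) xs)
⇒*-⋀ X (q ∷ K) = trans (⇒*-∧* X ⟦ q ⟧ K) (∧*-congˡ (map (X ▷_) K) (sym (▷-readback X q)))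

readback : ∀ A → A ≡ᵀ ⋀ (nf A)
readback τ       = refl
readback (A ∧ B) = begin
  A ∧ B               ≈⟨ cong∧ (readback A) (readback B) ⟩
  ⋀ (nf A) ∧ ⋀ (nf B) ≈⟨ ⋀-++ (nf A) (nf B) ⟨
  ⋀ (nf (A ∧ B))      ∎
readback (A ⇒ B) = begin
  A ⇒ B               ≈⟨ cong⇒ (readback A) (readback B) ⟩
  ⋀ (nf A) ⇒ ⋀ (nf B) ≈⟨ ⋀-curry (nf A) (⋀ (nf B)) ⟩
  NF A ⇒* ⋀ (nf B)    ≈⟨ ⇒*-⋀ (NF A) (nf B) ⟩
  ⋀ (nf (A ⇒ B))      ∎

nf-complete : ∀ {A B} → NF A ~ NF B → A ≡ᵀ B
nf-complete {A} {B} e = trans (readback A) (trans (⋀-cong e) (sym (readback B)))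

▷-singleton : ∀ X xs {Y} → toList (map⁺ (X ▷_) xs) ~ arr Y ∷ [] →
  Σ (List Prime) λ M → (xs ≡ arr M ∷ []) × (X ++ M ~ Y)
▷-singleton X (arr M ∷ []) e with ~-singleton e
... | _ , Eq.refl , arr-cong X++M~Y = M , Eq.refl , X++M~Y
▷-singleton X (_ ∷ _ ∷ _) e with ~-singleton e
... | _ , () , _

⇒τ-inversion : ∀ {A B C} → A ⇒ B ≡ᵀ C ⇒ τ →
  Σ (List Prime) λ M → (B ≡ᵀ M ⇒* τ) × (NF A ++ M ~ NF C)
⇒τ-inversion {A} {B} {C} e with ▷-singleton (NF A) (nf B) (sound e)
... | M , nfB≡arrM , A++M~C =
  M , Eq.subst (λ xs → B ≡ᵀ ⋀ xs) nfB≡arrM (readback B)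
    , ~-trans A++M~C (~-reflexive (++-identityʳ (NF C)))

mainTheorem20 : (A B C : Type) → (A ⇒ B) ≡ᵀ (C ⇒ τ) →
    ((A ≡ᵀ C) × (B ≡ᵀ τ)) ⊎ Σ Type (λ B' → (C ≡ᵀ (A ∧ B')) × (B ≡ᵀ (B' ⇒ τ)))
mainTheorem20 A B C A⇒B≡C⇒τ with ⇒τ-inversion A⇒B≡C⇒τ
... | [] , B≡τ , A++[]~C =
  inj₁ (nf-complete (~-trans (~-reflexive (Eq.sym (++-identityʳ (NF A)))) A++[]~C) , B≡τ)
... | m ∷ M , B≡M⇒τ , A++M~C =
  inj₂ (⋀ (m ∷ M) , C≡A∧B' , trans B≡M⇒τ (sym (⋀-curry (m ∷ M) τ)))
  where
  C≡A∧B' : C ≡ᵀ A ∧ ⋀ (m ∷ M)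
  C≡A∧B' = begin
    C                     ≈⟨ readback C ⟩
    ⋀ (nf C)              ≈⟨ ⋀-cong (~-sym A++M~C) ⟩
    ⋀ (nf A ⁺++⁺ m ∷ M)   ≈⟨ ⋀-++ (nf A) (m ∷ M) ⟩
    ⋀ (nf A) ∧ ⋀ (m ∷ M)  ≈⟨ cong∧ (sym (readback A)) refl ⟩
    A ∧ ⋀ (m ∷ M)         ∎
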